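{- Let $G$ be a graph. Then for every integer $k$ with $0\leq k\leq t(G)$ there exists a hull set $S$ of $G$ such that $t(G,S)=k$.
   Context: All graphs are finite and simple. In 2-neighbor bootstrap percolation on $G$, given $S\subseteq V(G)$ one sets $S_{(0)}=S$ and $S_{(i+1)}=S_{(i)}\cup\{v: v \text{ has at least two neighbors in } S_{(i)}\}$. $S$ is a hull set of $G$ if $S_{(t)}=V(G)$ for some $t$; then $t(G,S)$ is the minimum such $t$, and $t(G)=\max\{t(G,S): S \text{ a hull set of } G\}$. -}

module Defs where

open import Data.Nat using (ℕ; zero; suc; _≤_; _<_; _≤ᵇ_)
open import Data.Bool using (Bool; true; false; _∧_; _∨_; if_then_else_)
open import Data.Fin using (Fin)
open import Data.List using (List; map; allFin)
open import Data.Nat.ListAction using (sum)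
open import Data.Product using (Σ; _×_; ∃)
open import Relation.Binary.PropositionalEquality using (_≡_)
open import Relation.Nullary using (¬_)

record Graph (n : ℕ) : Set where
  field
    adj   : Fin n → Fin n → Bool
    sym   : ∀ u v → adj u v ≡ adj v u
    irref : ∀ v → adj v v ≡ false
open Graph public

VSet : ℕ → Set
VSet n = Fin n → Bool

nbrsIn : ∀ {n} → Graph n → VSet n → Fin n → ℕ
nbrsIn {n} G S v = sum (map (λ u → if adj G v u ∧ S u then 1 else 0) (allFin n))

-- one round of 2-neighbour bootstrap percolation
step : ∀ {n} → Graph n → VSet n → VSet n
step G S v = S v ∨ (2 ≤ᵇ nbrsIn G S v)

iter : ∀ {n} → Graph n → VSet n → ℕ → VSet n
iter G S zero    = S
iter G S (suc i) = step G (iter G S i)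

Full : ∀ {n} → VSet n → Set
Full {n} S = ∀ (v : Fin n) → S v ≡ true

IsHullSet : ∀ {n} → Graph n → VSet n → Set
IsHullSet G S = ∃ λ t → Full (iter G S t)

PercTime : ∀ {n} → Graph n → VSet n → ℕ → Set
PercTime G S k = Full (iter G S k) × (∀ j → j < k → ¬ Full (iter G S j))

IsMaxPercTime : ∀ {n} → Graph n → ℕ → Set
IsMaxPercTime G m =
  (Σ _ λ S → PercTime G S m) × (∀ S k → PercTime G S k → k ≤ m)

module Submission where

-- Idea: every intermediate stage of a percolating process is itself a hull
-- set, and it percolates in exactly the remaining number of rounds.
-- Take a hull set S with t(G,S) = m (the maximum).  For k ≤ m put
-- d = m ∸ k; the stage S_(d) satisfies (S_(d))_(j) = S_(d+j), so it fills
-- V(G) after k rounds and not earlier, i.e. t(G, S_(d)) = k.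

open import Defs
open import Data.Nat using (ℕ; _≤_; _<_; _+_; _∸_; zero; suc)
open import Data.Nat.Properties using (+-suc; +-identityʳ; m∸n+n≡m; +-monoʳ-<)
open import Data.Product using (Σ; _×_; _,_)
open import Relation.Binary.PropositionalEquality using (_≡_; refl; cong; subst) renaming (sym to ≡-sym)
open import Relation.Nullary using (¬_)

iter-+ : ∀ {n} (G : Graph n) (S : VSet n) (a j : ℕ) →
         iter G (iter G S a) j ≡ iter G S (a + j)
iter-+ G S a zero    rewrite +-identityʳ a = refl
iter-+ G S a (suc j) rewrite +-suc a j     = cong (step G) (iter-+ G S a j)

percTime-shift : ∀ {n} (G : Graph n) (S : VSet n) (d k : ℕ) →
                 PercTime G S (d + k) → PercTime G (iter G S d) k
percTime-shift G S d k (full , notEarlier) = fullAtK , notFullBeforeK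
  where
  fullAtK : Full (iter G (iter G S d) k)
  fullAtK = subst Full (≡-sym (iter-+ G S d k)) full

  notFullBeforeK : ∀ j → j < k → ¬ Full (iter G (iter G S d) j)
  notFullBeforeK j j<k fullAtJ =
    notEarlier (d + j) (+-monoʳ-< d j<k) (subst Full (iter-+ G S d j) fullAtJ)

percTime⇒hull : ∀ {n} (G : Graph n) (S : VSet n) (k : ℕ) →
                PercTime G S k → IsHullSet G S
percTime⇒hull G S k (full , _) = k , full

lemma1 : ∀ {n} (G : Graph n) (m : ℕ) → IsMaxPercTime G m →
    ∀ (k : ℕ) → k ≤ m → Σ (VSet n) λ S → IsHullSet G S × PercTime G S k
lemma1 G m ((S , timeM) , _) k k≤m =
  iter G S d , percTime⇒hull G (iter G S d) k timeK , timeK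
  where
  d : ℕ
  d = m ∸ k

  timeK : PercTime G (iter G S d) k
  timeK = percTime-shift G S d k (subst (PercTime G S) (≡-sym (m∸n+n≡m k≤m)) timeM)
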